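{- Let $k>3$ be an integer and let $\alpha_1,\dots,\alpha_m$ be the win partition of a $k$-regular graph (parts in increasing order). For every $w\in\left[\frac12,1\right)$ with $w\notin\alpha_{m-1}\cup\alpha_m$, there exist a $k$-regular graph $G$ and a configuration $C_0$ of $G$ such that the $w$-power index process with initial configuration $C_0$ eventually becomes periodic (with some period $\ell>1$).
   Context: All graphs are finite and simple. A configuration of a graph $G$ is a map $C:V(G)\to\{C,D\}$; vertices with value $C$ are collaborators, those with value $D$ defectors. $N[v]$ is the closed neighbourhood of $v$, $N_C[v]$ is the set of collaborators in $N[v]$ and $N_D[v]$ the set of defectors in $N[v]$. For a win condition $w\in\left[\frac12,1\right)$, the power of $v$ with respect to a configuration is: if $v$ is a collaborator, $p(v)=1/|N_C[v]|$ when $|N_C[v]|/|N[v]|>w$ and $p(v)=0$ otherwise; if $v$ is a defector, $p(v)=1/|N_D[v]|$ when $|N_C[v]|/|N[v]|\le w$ and $p(v)=0$ otherwise. The $w$-power index process with initial configuration $C_0$ produces configurations $C_1,C_2,\dots$: for $t\ge1$ each vertex $v$ simultaneously takes the strategy that, in $C_{t-1}$, is held by the vertex of $N[v]$ of greatest power (powers computed with respect to $C_{t-1}$); if the vertices of $N[v]$ of greatest power have differing strategies, then $C_t(v)=C_{t-1}(v)$. The process becomes periodic with period $\ell$ if $\ell>1$ is the least integer such that $C_i=C_{i+\ell}$ for some $i\ge0$. Win partition: for $v\in V(G)$ let $S_v=\{i/|N[v]| : i\in\mathbb Z,\ |N[v]|/2\le i\le |N[v]|\}$ and $S_G=\bigcup_{v}S_v$;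 writing $S_G=\{s_1<\dots<s_{|S_G|}\}$, the win partition is $\{[\tfrac12,s_1),[s_1,s_2),\dots,[s_{|S_G|-1},s_{|S_G|})\}$. For a $k$-regular graph this depends only on $k$, and its last two parts together are $[\frac{k-1}{k+1},1)$.
   Formalization: The win condition $w$ ranges only over the rational numbers in [½, 1). -}

module Defs where

open import Data.Bool using (Bool; true; false; T; if_then_else_; _∨_)
open import Data.Nat using (ℕ; zero; suc; _<_)
open import Data.Fin using (Fin; _≟_)
open import Data.List using (List; filter; length; map; foldr; allFin)
open import Data.Bool.ListAction using (all)
open import Data.Integer using (+_)
open import Data.Rational using (ℚ; _/_; _⊔_; 0ℚ) renaming (_<_ to _<ℚ_; _≤_ to _≤ℚ_)
import Data.Rational.Properties as ℚP
open import Relation.Nullary.Decidable using (⌊_⌋; does)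
open import Relation.Binary.PropositionalEquality using (_≡_)
open import Data.Product using (Σ; ∃; _×_)

record Graph : Set where
  field
    n     : ℕ
    adj   : Fin n → Fin n → Bool
    sym   : ∀ u v → adj u v ≡ adj v u
    irref : ∀ v → adj v v ≡ false
open Graph public

nbrs : (G : Graph) → Fin (n G) → List (Fin (n G))
nbrs G v = filter (λ u → T? (adj G v u)) (allFin (n G))
  where open import Data.Bool using (T?)

closedN : (G : Graph) → Fin (n G) → List (Fin (n G))
closedN G v = filter (λ u → T? (does (u ≟ v) ∨ adj G v u)) (allFin (n G))
  where open import Data.Bool using (T?)

Regular : ℕ → Graph → Set
Regular k G = ∀ v → length (nbrs G v) ≡ k

data Strategy : Set where
  C D : Strategy

isC : Strategy → Bool
isC C = true
isC D = false

isD : Strategy → Bool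
isD C = false
isD D = true

Configuration : Graph → Set
Configuration G = Fin (n G) → Strategy

-- a / b as a rational (b = 0 never occurs in our uses; it is mapped to 0)
ratio : ℕ → ℕ → ℚ
ratio a zero    = 0ℚ
ratio a (suc b) = (+ a) / suc b

module _ (G : Graph) (w : ℚ) (Cf : Configuration G) where

  NC : Fin (n G) → List (Fin (n G))
  NC v = filter (λ u → T? (isC (Cf u))) (closedN G v)
    where open import Data.Bool using (T?)

  ND : Fin (n G) → List (Fin (n G))
  ND v = filter (λ u → T? (isD (Cf u))) (closedN G v)
    where open import Data.Bool using (T?)

  collabWins : Fin (n G) → Bool
  collabWins v = does (w ℚP.<? ratio (length (NC v)) (length (closedN G v)))

  power : Fin (n G) → ℚ
  power v with Cf v | collabWins v
  ... | C | true  = ratio 1 (length (NC v))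
  ... | C | false = 0ℚ
  ... | D | true  = 0ℚ
  ... | D | false = ratio 1 (length (ND v))

  maxPower : Fin (n G) → ℚ
  maxPower v = foldr _⊔_ 0ℚ (map power (closedN G v))

  strongest : Fin (n G) → List (Fin (n G))
  strongest v = filter (λ u → power u ℚP.≟ maxPower v) (closedN G v)

  step : Configuration G
  step v =
    if all (λ u → isC (Cf u)) (strongest v) then C
    else if all (λ u → isD (Cf u)) (strongest v) then D
    else Cf v

process : (G : Graph) → ℚ → Configuration G → ℕ → Configuration G
process G w C0 zero    = C0
process G w C0 (suc t) = step G w (process G w C0 t)

Recurs : (G : Graph) → ℚ → Configuration G → ℕ → Set
Recurs G w C0 ℓ = ∃ λ i → ∀ v → process G w C0 i v ≡ process G w C0 (i Data.Nat.+ ℓ) v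

PeriodicWithPeriod : (G : Graph) → ℚ → Configuration G → ℕ → Set
PeriodicWithPeriod G w C0 ℓ =
  1 < ℓ × Recurs G w C0 ℓ × (∀ ℓ' → 0 < ℓ' → ℓ' < ℓ → Recurs G w C0 ℓ' → Data.Empty.⊥)
  where import Data.Empty

-- union of the last two parts of the win partition of a k-regular graph,
-- [ (k-1)/(k+1), 1 )  (as given in the paper's context)
InLastTwoParts : ℕ → ℚ → Set
InLastTwoParts k w = (ratio (k Data.Nat.∸ 1) (suc k) ≤ℚ w) × (w <ℚ 1ℚ)
  where open Data.Rational using (1ℚ)

-- Proof idea, with k = m + 4. Blow up the path K – X – Z – Y – W – V into blocks of sizes
-- k − 1, 2, 1, k − 2, k − 1, 2, make K and V cliques and join consecutive blocks completely;
-- the result is k-regular. Start with the collaborators exactly on K. Since w < (k − 1)/(k + 1),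
-- collaborators win on K and on X, so the vertices of K have power 1/(k − 1) while every
-- defector has power 0 or at most 1/(k + 1): X turns collaborator. Then the single vertex of Z
-- sees only the 2 collaborators of X among its k + 1 closed neighbours, so defectors win there
-- (2/(k + 1) ≤ 1/2 ≤ w) and it has power 1/(k − 1), more than any collaborator (at most 1/k):
-- X turns back, while K, Y, W and V never change. The process therefore alternates with period 2.

module Submission where

open import Defs
open import Data.Nat using (ℕ; _<_)
open import Data.Rational using (ℚ; ½; 1ℚ) renaming (_<_ to _<ℚ_; _≤_ to _≤ℚ_)
open import Data.Product using (Σ; ∃; _×_)
open import Relation.Nullary using (¬_)

open import Data.Bool using (Bool; true; false; T; T?; if_then_else_; not; _∧_; _∨_)
open import Data.Bool.ListAction using (all)
open import Data.Bool.Properties using (∨-comm; ∧-identityʳ; ∧-zeroʳ; T-∧)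
open import Data.Empty using (⊥)
open import Data.Fin using (Fin; zero; suc; _≟_; splitAt; _↑ˡ_; _↑ʳ_)
open import Data.Fin.Properties using (splitAt-↑ˡ; splitAt-↑ʳ)
import Data.Integer as ℤ
import Data.Integer.Properties as ℤP
open import Data.List using (List; []; _∷_; filter; length; map; foldr; tabulate; allFin)
open import Data.Nat.ListAction using (sum)
open import Data.List.Membership.Propositional using (_∈_)
open import Data.List.Membership.Propositional.Properties using (∈-filter⁺; ∈-filter⁻; ∈-allFin)
open import Data.List.Relation.Unary.Any using (here; there)
open import Data.Nat using (zero; suc; _+_; _*_; _≤_; z≤n; s≤s)
import Data.Nat.Properties as ℕP
open import Algebra.Properties.CommutativeSemigroup ℕP.+-commutativeSemigroup
  using (x∙yz≈y∙xz; x∙yz≈xz∙y)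
open import Data.Product using (_,_; proj₁; proj₂)
open import Data.Rational using (0ℚ; _⊔_)
import Data.Rational.Properties as ℚP
open import Data.Rational.Unnormalised using (mkℚᵘ; *≤*; *<*)
import Data.Rational.Unnormalised.Properties as ℚᵘP
open import Data.Sum using (_⊎_; inj₁; inj₂; [_,_]′)
import Data.Sum as Sum
open import Function using (_∘_; id; Equivalence)
open import Relation.Binary.PropositionalEquality
  using (_≡_; _≢_; refl; cong; cong₂; trans; subst; subst₂; module ≡-Reasoning)
  renaming (sym to ≡-sym)
open import Relation.Nullary using (Dec; yes; no; contradiction)
open import Relation.Nullary.Decidable using (does; dec-true; dec-false)

-- Counting

iverson : Bool → ℕ
iverson true  = 1
iverson false = 0

count : (k : ℕ) → (Fin k → Bool) → ℕ
count zero    p = 0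
count (suc k) p = iverson (p zero) + count k (p ∘ suc)

count-cong : ∀ {k} {p q : Fin k → Bool} → (∀ i → p i ≡ q i) → count k p ≡ count k q
count-cong {zero}  p≗q = refl
count-cong {suc k} p≗q = cong₂ _+_ (cong iverson (p≗q zero)) (count-cong (p≗q ∘ suc))

count-const : ∀ k b → count k (λ _ → b) ≡ (if b then k else 0)
count-const zero    true  = refl
count-const zero    false = refl
count-const (suc k) true  = cong suc (count-const k true)
count-const (suc k) false = count-const k false

count-splitAt : ∀ a b (p : Fin a ⊎ Fin b → Bool) →
                count (a + b) (p ∘ splitAt a) ≡ count a (p ∘ inj₁) + count b (p ∘ inj₂)
count-splitAt zero    b p = refl
count-splitAt (suc a) b p =
  trans (cong (iverson (p (inj₁ zero)) +_) (count-splitAt a b (p ∘ Sum.map₁ suc)))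
        (≡-sym (ℕP.+-assoc (iverson (p (inj₁ zero))) _ _))

count-insert : ∀ {k} (v : Fin k) (p q : Fin k → Bool) →
               count k (λ u → p u ∧ (does (u ≟ v) ∨ q u)) ≡
               iverson (p v ∧ not (q v)) + count k (λ u → p u ∧ q u)
count-insert zero    p q = split (p zero) (q zero)
  where
  split : ∀ a b {c} → iverson (a ∧ true) + c ≡ iverson (a ∧ not b) + (iverson (a ∧ b) + c)
  split true  true  = refl
  split true  false = refl
  split false _     = refl
count-insert (suc v) p q =
  trans (cong (iverson (p zero ∧ q zero) +_) (count-insert v (p ∘ suc) (q ∘ suc)))
        (x∙yz≈y∙xz (iverson (p zero ∧ q zero)) (iverson (p (suc v) ∧ not (q (suc v)))) _)

does-≟-sym : ∀ {k} (u v : Fin k) → does (u ≟ v) ≡ does (v ≟ u)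
does-≟-sym u v with u ≟ v | v ≟ u
... | yes _    | yes _    = refl
... | no _     | no _     = refl
... | yes refl | no v≢u   = contradiction refl v≢u
... | no u≢v   | yes refl = contradiction refl u≢v

length-filter-tabulate : ∀ {A : Set} {k} (p : A → Bool) (f : Fin k → A) →
                         length (filter (T? ∘ p) (tabulate f)) ≡ count k (p ∘ f)
length-filter-tabulate {k = zero}  p f = refl
length-filter-tabulate {k = suc k} p f with p (f zero)
... | true  = cong suc (length-filter-tabulate p (f ∘ suc))
... | false = length-filter-tabulate p (f ∘ suc)

length-filter-∧ : ∀ {A : Set} (p q : A → Bool) xs →
                  length (filter (T? ∘ p) (filter (T? ∘ q) xs)) ≡
                  length (filter (λ x → T? (p x ∧ q x)) xs)
length-filter-∧ p q []       = refl
length-filter-∧ p q (x ∷ xs) with q x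
... | false rewrite ∧-zeroʳ (p x) = length-filter-∧ p q xs
... | true with p x
...   | true  = cong suc (length-filter-∧ p q xs)
...   | false = length-filter-∧ p q xs

-- ratio a (suc b) is definitionally fromℚᵘ (mkℚᵘ (+ a) b), so it is compared by cross-multiplication.
ratio-≤ : ∀ a b c d → a * suc d ≤ c * suc b → ratio a (suc b) ≤ℚ ratio c (suc d)
ratio-≤ a b c d ad≤cb = ℚP.toℚᵘ-cancel-≤
  (ℚᵘP.≤-respˡ-≃ (ℚᵘP.≃-sym (ℚP.toℚᵘ-fromℚᵘ (mkℚᵘ (ℤ.+ a) b)))
  (ℚᵘP.≤-respʳ-≃ (ℚᵘP.≃-sym (ℚP.toℚᵘ-fromℚᵘ (mkℚᵘ (ℤ.+ c) d)))
  (*≤* (subst₂ ℤ._≤_ (ℤP.pos-* a (suc d)) (ℤP.pos-* c (suc b)) (ℤ.+≤+ ad≤cb)))))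

ratio-< : ∀ a b c d → a * suc d < c * suc b → ratio a (suc b) <ℚ ratio c (suc d)
ratio-< a b c d ad<cb = ℚP.toℚᵘ-cancel-<
  (ℚᵘP.<-respˡ-≃ (ℚᵘP.≃-sym (ℚP.toℚᵘ-fromℚᵘ (mkℚᵘ (ℤ.+ a) b)))
  (ℚᵘP.<-respʳ-≃ (ℚᵘP.≃-sym (ℚP.toℚᵘ-fromℚᵘ (mkℚᵘ (ℤ.+ c) d)))
  (*<* (subst₂ ℤ._<_ (ℤP.pos-* a (suc d)) (ℤP.pos-* c (suc b)) (ℤ.+<+ ad<cb)))))

ratio-nonneg : ∀ a b → 0ℚ ≤ℚ ratio a b
ratio-nonneg a zero    = ℚP.≤-refl
ratio-nonneg a (suc b) = ratio-≤ 0 0 a b z≤n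

1/-antimono-≤ : ∀ {a b} → a ≤ b → ratio 1 (suc b) ≤ℚ ratio 1 (suc a)
1/-antimono-≤ {a} {b} a≤b = ratio-≤ 1 b 1 a (ℕP.+-monoˡ-≤ 0 (s≤s a≤b))

1/-antimono-< : ∀ {a b} → a < b → ratio 1 (suc b) <ℚ ratio 1 (suc a)
1/-antimono-< {a} {b} a<b = ratio-< 1 b 1 a (ℕP.+-monoˡ-< 0 (s≤s a<b))

module _ (G : Graph) where

  length-closedN : ∀ v → length (closedN G v) ≡ count (n G) (λ u → does (u ≟ v) ∨ adj G v u)
  length-closedN v = length-filter-tabulate (λ u → does (u ≟ v) ∨ adj G v u) id

  length-filter-closedN : ∀ (p : Fin (n G) → Bool) v →
    length (filter (T? ∘ p) (closedN G v)) ≡ count (n G) (λ u → p u ∧ (does (u ≟ v) ∨ adj G v u))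
  length-filter-closedN p v =
    trans (length-filter-∧ p (λ u → does (u ≟ v) ∨ adj G v u) (allFin _))
          (length-filter-tabulate (λ u → p u ∧ (does (u ≟ v) ∨ adj G v u)) id)

  length-closedN≡suc-nbrs : ∀ v → length (closedN G v) ≡ suc (length (nbrs G v))
  length-closedN≡suc-nbrs v = begin
    length (closedN G v)
      ≡⟨ length-closedN v ⟩
    count (n G) (λ u → does (u ≟ v) ∨ adj G v u)
      ≡⟨ count-insert v (λ _ → true) (adj G v) ⟩
    iverson (not (adj G v v)) + count (n G) (adj G v)
      ≡⟨ cong (λ b → iverson (not b) + count (n G) (adj G v)) (irref G v) ⟩
    suc (count (n G) (adj G v))
      ≡⟨ cong suc (≡-sym (length-filter-tabulate (adj G v) id)) ⟩
    suc (length (nbrs G v))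
      ∎
    where open ≡-Reasoning

  ∈-closedN⁺ : ∀ {u v} → T (does (u ≟ v) ∨ adj G v u) → u ∈ closedN G v
  ∈-closedN⁺ {u} {v} = ∈-filter⁺ (λ u → T? (does (u ≟ v) ∨ adj G v u)) (∈-allFin u)

  ∈-closedN⁻ : ∀ {u v} → u ∈ closedN G v → T (does (u ≟ v) ∨ adj G v u)
  ∈-closedN⁻ {u} {v} u∈ =
    proj₂ (∈-filter⁻ (λ u → T? (does (u ≟ v) ∨ adj G v u)) {xs = allFin _} u∈)

  v∈closedN : ∀ v → v ∈ closedN G v
  v∈closedN v = ∈-closedN⁺ (self (v ≟ v))
    where
    self : (d : Dec (v ≡ v)) → T (does d ∨ adj G v v)
    self (yes _)  = _
    self (no v≢v) = contradiction refl v≢v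

-- Powers and steps of the process

≤-foldr-⊔ : ∀ {A : Set} (f : A → ℚ) {x xs} → x ∈ xs → f x ≤ℚ foldr _⊔_ 0ℚ (map f xs)
≤-foldr-⊔ f (here refl)                = ℚP.p≤p⊔q (f _) _
≤-foldr-⊔ f {xs = y ∷ _} (there x∈xs) = ℚP.p≤q⇒p≤r⊔q (f y) (≤-foldr-⊔ f x∈xs)

foldr-⊔-attained : ∀ {A : Set} (f : A → ℚ) → (∀ x → 0ℚ ≤ℚ f x) → ∀ {y xs} → y ∈ xs →
                   ∃ λ x → x ∈ xs × f x ≡ foldr _⊔_ 0ℚ (map f xs)
foldr-⊔-attained f nonneg {xs = x ∷ []} _ = x , here refl , ≡-sym (ℚP.p≥q⇒p⊔q≡p (nonneg x))
foldr-⊔-attained f nonneg {xs = x ∷ y ∷ ys} _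
  with foldr-⊔-attained f nonneg {xs = y ∷ ys} (here refl)
     | ℚP.⊔-sel (f x) (foldr _⊔_ 0ℚ (map f (y ∷ ys)))
... | _                | inj₁ max≡fx   = x , here refl , ≡-sym max≡fx
... | x′ , x′∈ , x′-max | inj₂ max≡rest = x′ , there x′∈ , trans x′-max (≡-sym max≡rest)

all≡true : ∀ {A : Set} (p : A → Bool) {xs} → (∀ x → x ∈ xs → p x ≡ true) → all p xs ≡ true
all≡true p {[]}     _   = refl
all≡true p {x ∷ xs} all-p rewrite all-p x (here refl) = all≡true p (λ y y∈ → all-p y (there y∈))

all≡false : ∀ {A : Set} (p : A → Bool) {x xs} → x ∈ xs → p x ≡ false → all p xs ≡ false
all≡false p (here refl) px≡false rewrite px≡false = refl
all≡false p {xs = y ∷ _} (there x∈xs) px≡false with p y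
... | true  = all≡false p x∈xs px≡false
... | false = refl

C-or-D : ∀ s → s ≡ C ⊎ s ≡ D
C-or-D C = inj₁ refl
C-or-D D = inj₂ refl

module _ (G : Graph) (w : ℚ) (F : Configuration G) where

  CollaboratorsWin : Fin (n G) → Set
  CollaboratorsWin v = w <ℚ ratio (length (NC G w F v)) (length (closedN G v))

  power-nonneg : ∀ v → 0ℚ ≤ℚ power G w F v
  power-nonneg v with F v | collabWins G w F v
  ... | C | true  = ratio-nonneg 1 (length (NC G w F v))
  ... | C | false = ℚP.≤-refl
  ... | D | true  = ℚP.≤-refl
  ... | D | false = ratio-nonneg 1 (length (ND G w F v))

  power≤1/∣NC∣ : ∀ v → F v ≡ C → power G w F v ≤ℚ ratio 1 (length (NC G w F v))
  power≤1/∣NC∣ v Fv≡C with F v | collabWins G w F v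
  power≤1/∣NC∣ _ refl | C | true  = ℚP.≤-refl
  power≤1/∣NC∣ v refl | C | false = ratio-nonneg 1 (length (NC G w F v))

  power≤1/∣ND∣ : ∀ v → F v ≡ D → power G w F v ≤ℚ ratio 1 (length (ND G w F v))
  power≤1/∣ND∣ v Fv≡D with F v | collabWins G w F v
  power≤1/∣ND∣ v refl | D | true  = ratio-nonneg 1 (length (ND G w F v))
  power≤1/∣ND∣ _ refl | D | false = ℚP.≤-refl

  C-wins⇒power≡1/∣NC∣ : ∀ v → F v ≡ C → CollaboratorsWin v →
                        power G w F v ≡ ratio 1 (length (NC G w F v))
  C-wins⇒power≡1/∣NC∣ v Fv≡C win with F v | collabWins G w F v | dec-true (w ℚP.<? _) win
  C-wins⇒power≡1/∣NC∣ _ refl _ | C | true | _ = refl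

  C-wins⇒power≡0 : ∀ v → F v ≡ D → CollaboratorsWin v → power G w F v ≡ 0ℚ
  C-wins⇒power≡0 v Fv≡D win with F v | collabWins G w F v | dec-true (w ℚP.<? _) win
  C-wins⇒power≡0 _ refl _ | D | true | _ = refl

  D-wins⇒power≡1/∣ND∣ : ∀ v → F v ≡ D → ¬ CollaboratorsWin v →
                        power G w F v ≡ ratio 1 (length (ND G w F v))
  D-wins⇒power≡1/∣ND∣ v Fv≡D lose with F v | collabWins G w F v | dec-false (w ℚP.<? _) lose
  D-wins⇒power≡1/∣ND∣ _ refl _ | D | false | _ = refl

  -- maxPower folds ⊔ from 0ℚ, so it is attained only because powers are nonnegative.
  maxPower-attained : ∀ v → ∃ λ u → u ∈ closedN G v × power G w F u ≡ maxPower G w F v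
  maxPower-attained v = foldr-⊔-attained (power G w F) power-nonneg (v∈closedN G v)

  -- The witness x is needed for s = D: on an empty list the test for C would succeed first.
  step-unanimous : ∀ v s {x} → x ∈ strongest G w F v →
                   (∀ u → u ∈ strongest G w F v → F u ≡ s) → step G w F v ≡ s
  step-unanimous v C _ all-C
    rewrite all≡true (λ u → isC (F u)) (λ u u∈ → cong isC (all-C u u∈)) = refl
  step-unanimous v D x∈ all-D
    rewrite all≡false (λ u → isC (F u)) x∈ (cong isC (all-D _ x∈))
          | all≡true (λ u → isD (F u)) (λ u u∈ → cong isD (all-D u u∈)) = refl

  step-adopts : ∀ v s (q : ℚ) u₀ → u₀ ∈ closedN G v → q ≤ℚ power G w F u₀ →
                (∀ u → u ∈ closedN G v → F u ≡ s ⊎ power G w F u <ℚ q) → step G w F v ≡ s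
  step-adopts v s q u₀ u₀∈ q≤u₀ dominated with maxPower-attained v
  ... | x , x∈ , x-max = step-unanimous v s (∈-filter⁺ strongest? x∈ x-max) strongest-play-s
    where
    strongest? : ∀ u → Dec (power G w F u ≡ maxPower G w F v)
    strongest? u = power G w F u ℚP.≟ maxPower G w F v

    strongest-play-s : ∀ u → u ∈ strongest G w F v → F u ≡ s
    strongest-play-s u u∈ with ∈-filter⁻ strongest? {xs = closedN G v} u∈
    ... | u∈N , u-max with dominated u u∈N
    ...   | inj₁ Fu≡s = Fu≡s
    ...   | inj₂ u<q  = contradiction
      (ℚP.<-≤-trans u<q (ℚP.≤-trans q≤u₀ (≤-foldr-⊔ (power G w F) u₀∈))) (ℚP.<-irrefl u-max)

  step-uniform : ∀ v s → (∀ u → u ∈ closedN G v → F u ≡ s) → step G w F v ≡ s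
  step-uniform v s all-s =
    step-adopts v s 0ℚ v (v∈closedN G v) (power-nonneg v) (λ u u∈ → inj₁ (all-s u u∈))

period-two : ∀ G w (C₀ : Configuration G) →
             (∀ v → process G w C₀ 2 v ≡ C₀ v) →
             (∀ t → ∃ λ v → process G w C₀ t v ≢ process G w C₀ (suc t) v) →
             PeriodicWithPeriod G w C₀ 2
period-two G w C₀ returns moves = s≤s (s≤s z≤n) , (0 , λ v → ≡-sym (returns v)) , minimal
  where
  minimal : ∀ ℓ → 0 < ℓ → ℓ < 2 → Recurs G w C₀ ℓ → ⊥
  minimal (suc zero) _ _ (i , recurs) with moves i
  ... | v , moved = moved (trans (recurs v) (cong (λ t → process G w C₀ t v) (ℕP.+-comm i 1)))
  minimal (suc (suc _)) _ (s≤s (s≤s ())) _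

-- Blow-ups of block graphs

-- Fin order is cut into consecutive intervals of lengths size b, one for each entry b of blocks.
-- Distinct vertices are adjacent iff their blocks are joined, so a block joined to itself is a
-- clique and any other block an independent set.
module BlowUp {B : Set} (size : B → ℕ) (joined : B → B → Bool)
              (joined-sym : ∀ b b′ → joined b b′ ≡ joined b′ b) (blocks : List B) where

  blockIn : ∀ bs → Fin (sum (map size bs)) → B
  blockIn (b ∷ bs) u = [ (λ _ → b) , blockIn bs ]′ (splitAt (size b) u)

  vertexIn : ∀ {b} bs → b ∈ bs → Fin (size b) → Fin (sum (map size bs))
  vertexIn (b ∷ bs) (here refl) j = j ↑ˡ sum (map size bs)
  vertexIn (b ∷ bs) (there b∈)  j = size b ↑ʳ vertexIn bs b∈ j

  blockIn-vertexIn : ∀ {b} bs (b∈ : b ∈ bs) j → blockIn bs (vertexIn bs b∈ j) ≡ b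
  blockIn-vertexIn (b ∷ bs) (here refl) j = cong [ (λ _ → b) , blockIn bs ]′ (splitAt-↑ˡ (size b) j _)
  blockIn-vertexIn (b ∷ bs) (there b∈)  j =
    trans (cong [ (λ _ → b) , blockIn bs ]′ (splitAt-↑ʳ (size b) _ (vertexIn bs b∈ j)))
          (blockIn-vertexIn bs b∈ j)

  count-blockIn : ∀ bs (r : B → Bool) →
                  count (sum (map size bs)) (r ∘ blockIn bs) ≡
                  sum (map (λ b → if r b then size b else 0) bs)
  count-blockIn []       r = refl
  count-blockIn (b ∷ bs) r =
    trans (count-splitAt (size b) _ (r ∘ [ (λ _ → b) , blockIn bs ]′))
          (cong₂ _+_ (count-const (size b) (r b)) (count-blockIn bs r))

  order : ℕ
  order = sum (map size blocks)

  block : Fin order → B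
  block = blockIn blocks

  vertex : ∀ {b} → b ∈ blocks → Fin (size b) → Fin order
  vertex = vertexIn blocks

  block-vertex : ∀ {b} (b∈ : b ∈ blocks) j → block (vertex b∈ j) ≡ b
  block-vertex = blockIn-vertexIn blocks

  adjacent : Fin order → Fin order → Bool
  adjacent u v = joined (block u) (block v) ∧ not (does (u ≟ v))

  graph : Graph
  graph = record { n = order ; adj = adjacent ; sym = adjacent-sym ; irref = adjacent-irrefl }
    where
    adjacent-sym : ∀ u v → adjacent u v ≡ adjacent v u
    adjacent-sym u v = cong₂ _∧_ (joined-sym (block u) (block v)) (cong not (does-≟-sym u v))

    adjacent-irrefl : ∀ v → adjacent v v ≡ false
    adjacent-irrefl v with v ≟ v
    ... | yes _  = ∧-zeroʳ (joined (block v) (block v))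
    ... | no v≢v = contradiction refl v≢v

  weight : (B → Bool) → ℕ
  weight r = sum (map (λ b → if r b then size b else 0) blocks)

  -- v itself is counted by the weight iff its block is a clique.
  closedCount : (B → Bool) → B → ℕ
  closedCount r b = iverson (r b ∧ not (joined b b)) + weight (λ b′ → r b′ ∧ joined b b′)

  count-closedN : ∀ (p : Fin order → Bool) r → (∀ u → p u ≡ r (block u)) → ∀ v →
                  count order (λ u → p u ∧ (does (u ≟ v) ∨ adjacent v u)) ≡ closedCount r (block v)
  count-closedN p r p≗r v = begin
    count order (λ u → p u ∧ (does (u ≟ v) ∨ adjacent v u))
      ≡⟨ count-cong pointwise ⟩
    count order (λ u → r (block u) ∧ (does (u ≟ v) ∨ joined (block v) (block u)))
      ≡⟨ count-insert v (r ∘ block) (joined (block v) ∘ block) ⟩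
    iverson (r (block v) ∧ not (joined (block v) (block v))) +
    count order (λ u → r (block u) ∧ joined (block v) (block u))
      ≡⟨ cong (iverson (r (block v) ∧ not (joined (block v) (block v))) +_)
              (count-blockIn blocks (λ b → r b ∧ joined (block v) b)) ⟩
    closedCount r (block v) ∎
    where
    open ≡-Reasoning
    pointwise : ∀ u → p u ∧ (does (u ≟ v) ∨ adjacent v u) ≡
                      r (block u) ∧ (does (u ≟ v) ∨ joined (block v) (block u))
    pointwise u rewrite p≗r u with u ≟ v | v ≟ u
    ... | yes _  | _        = refl
    ... | no _   | no _     = cong (r (block u) ∧_) (∧-identityʳ _)
    ... | no u≢v | yes refl = contradiction refl u≢v

  length-closedN-blocks : ∀ v → length (closedN graph v) ≡ closedCount (λ _ → true) (block v)
  length-closedN-blocks v =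
    trans (length-closedN graph v) (count-closedN (λ _ → true) (λ _ → true) (λ _ → refl) v)

  length-filter-closedN-blocks : ∀ (p : Fin order → Bool) r → (∀ u → p u ≡ r (block u)) → ∀ v →
                                 length (filter (T? ∘ p) (closedN graph v)) ≡ closedCount r (block v)
  length-filter-closedN-blocks p r p≗r v =
    trans (length-filter-closedN graph p v) (count-closedN p r p≗r v)

  joined⇒∈closedN : ∀ u v {b b′} → block v ≡ b → block u ≡ b′ → T (joined b b′) →
                    u ∈ closedN graph v
  joined⇒∈closedN u v refl refl j = ∈-closedN⁺ graph (member (u ≟ v) (v ≟ u))
    where
    member : (d : Dec (u ≡ v)) (d′ : Dec (v ≡ u)) →
             T (does d ∨ (joined (block v) (block u) ∧ not (does d′)))
    member (yes _)  _           = _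
    member (no _)   (no _)      = subst T (≡-sym (∧-identityʳ _)) j
    member (no u≢v) (yes refl)  = contradiction refl u≢v

  ∈closedN⇒joined : ∀ u v → u ∈ closedN graph v → u ≡ v ⊎ T (joined (block v) (block u))
  ∈closedN⇒joined u v u∈ with u ≟ v | ∈-closedN⁻ graph u∈
  ... | yes u≡v | _ = inj₁ u≡v
  ... | no _    | t = inj₂ (proj₁ (Equivalence.to T-∧ t))

-- The oscillating gadget

data Block : Set where
  K X Z Y W V : Block

module Gadget (m : ℕ) where

  size : Block → ℕ
  size K = 3 + m
  size X = 2
  size Z = 1
  size Y = 2 + m
  size W = 3 + m
  size V = 2

  linked : Block → Block → Bool
  linked K K = true
  linked K X = true
  linked X Z = true
  linked Z Y = true
  linked Y W = true
  linked W V = true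
  linked V V = true
  linked _ _ = false

  joined : Block → Block → Bool
  joined b b′ = linked b b′ ∨ linked b′ b

  open BlowUp size joined (λ b b′ → ∨-comm (linked b b′) (linked b′ b))
              (K ∷ X ∷ Z ∷ Y ∷ W ∷ V ∷ []) public

  G : Graph
  G = graph

  k₀ x₀ z₀ : Fin order
  k₀ = vertex (here refl) zero
  x₀ = vertex (there (here refl)) zero
  z₀ = vertex (there (there (here refl))) zero

  block-k₀ : block k₀ ≡ K
  block-k₀ = block-vertex (here refl) zero

  block-x₀ : block x₀ ≡ X
  block-x₀ = block-vertex (there (here refl)) zero

  block-z₀ : block z₀ ≡ Z
  block-z₀ = block-vertex (there (there (here refl))) zero

  -- Each block count below normalises to a + (m + b) for numerals a and b.
  shift : ∀ a b → a + (m + b) ≡ a + b + m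
  shift a b = x∙yz≈xz∙y a m b

  closed-size : ∀ b → closedCount (λ _ → true) b ≡ 5 + m
  closed-size K = shift 3 2
  closed-size X = shift 4 1
  closed-size Z = shift 5 0
  closed-size Y = shift 5 0
  closed-size W = shift 3 2
  closed-size V = shift 3 2

  ∣closedN∣ : ∀ v → length (closedN G v) ≡ 5 + m
  ∣closedN∣ v = trans (length-closedN-blocks v) (closed-size (block v))

  regular : Regular (4 + m) G
  regular v = ℕP.suc-injective (trans (≡-sym (length-closedN≡suc-nbrs G v)) (∣closedN∣ v))

  C-on-K C-on-KX : Block → Strategy
  C-on-K K = C
  C-on-K _ = D

  C-on-KX K = C
  C-on-KX X = C
  C-on-KX _ = D

  phase : ℕ → Block → Strategy
  phase zero          = C-on-K
  phase (suc zero)    = C-on-KX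
  phase (suc (suc t)) = phase t

  phase-moves-X : ∀ t → phase t X ≢ phase (suc t) X
  phase-moves-X zero          ()
  phase-moves-X (suc zero)    ()
  phase-moves-X (suc (suc t)) = phase-moves-X t

  -- Configurations are tracked up to pointwise equality, so no congruence lemma for step is needed.
  Agrees : Configuration G → (Block → Strategy) → Set
  Agrees F cfg = ∀ u → F u ≡ cfg (block u)

  Surrounded : (Block → Strategy) → Block → Set
  Surrounded cfg b = ∀ b′ → T (joined b b′) → cfg b′ ≡ cfg b

  module Dynamics (w : ℚ) (½≤w : ½ ≤ℚ w) (w<k-1/k+1 : w <ℚ ratio (3 + m) (5 + m)) where

    module AgreesWith (cfg : Block → Strategy) {F : Configuration G} (agree : Agrees F cfg) where

      ∣NC∣≡ : ∀ v {b c} → block v ≡ b → closedCount (isC ∘ cfg) b ≡ c → length (NC G w F v) ≡ c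
      ∣NC∣≡ v refl count≡c =
        trans (length-filter-closedN-blocks (isC ∘ F) (isC ∘ cfg) (cong isC ∘ agree) v) count≡c

      ∣ND∣≡ : ∀ v {b c} → block v ≡ b → closedCount (isD ∘ cfg) b ≡ c → length (ND G w F v) ≡ c
      ∣ND∣≡ v refl count≡c =
        trans (length-filter-closedN-blocks (isD ∘ F) (isD ∘ cfg) (cong isD ∘ agree) v) count≡c

      C-power≤ : ∀ v {b c} → block v ≡ b → closedCount (isC ∘ cfg) b ≡ c → F v ≡ C →
                 power G w F v ≤ℚ ratio 1 c
      C-power≤ v eq count≡c Fv≡C =
        subst (λ c → power G w F v ≤ℚ ratio 1 c) (∣NC∣≡ v eq count≡c) (power≤1/∣NC∣ G w F v Fv≡C)

      D-power≤ : ∀ v {b c} → block v ≡ b → closedCount (isD ∘ cfg) b ≡ c → F v ≡ D →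
                 power G w F v ≤ℚ ratio 1 c
      D-power≤ v eq count≡c Fv≡D =
        subst (λ c → power G w F v ≤ℚ ratio 1 c) (∣ND∣≡ v eq count≡c) (power≤1/∣ND∣ G w F v Fv≡D)

      C-wins : ∀ v {a} → length (NC G w F v) ≡ a → w <ℚ ratio a (5 + m) → CollaboratorsWin G w F v
      C-wins v ∣NC∣≡a = subst₂ (λ a b → w <ℚ ratio a b) (≡-sym ∣NC∣≡a) (≡-sym (∣closedN∣ v))

      plays : ∀ v {b} → block v ≡ b → F v ≡ cfg b
      plays v refl = agree v

      uniform : ∀ v {b} → block v ≡ b → Surrounded cfg b → ∀ u → u ∈ closedN G v → F u ≡ cfg b
      uniform v refl around u u∈ with ∈closedN⇒joined u v u∈
      ... | inj₁ refl = agree v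
      ... | inj₂ j    = trans (agree u) (around (block u) j)

      settled : ∀ v {b} → block v ≡ b → Surrounded cfg b → step G w F v ≡ cfg b
      settled v eq around = step-uniform G w F v _ (uniform v eq around)

    1/k<1/k-1 : ratio 1 (4 + m) <ℚ ratio 1 (3 + m)
    1/k<1/k-1 = 1/-antimono-< (ℕP.n<1+n (2 + m))

    1/k+1≤1/k : ratio 1 (5 + m) ≤ℚ ratio 1 (4 + m)
    1/k+1≤1/k = 1/-antimono-≤ (ℕP.n≤1+n (3 + m))

    module _ {F : Configuration G} (agree : Agrees F C-on-K) where

      open AgreesWith C-on-K agree

      K-power : ∀ v → block v ≡ K → power G w F v ≡ ratio 1 (3 + m)
      K-power v eq =
        trans (C-wins⇒power≡1/∣NC∣ G w F v (plays v eq) (C-wins v ∣NC∣≡3+m w<k-1/k+1))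
              (cong (ratio 1) ∣NC∣≡3+m)
        where
        ∣NC∣≡3+m : length (NC G w F v) ≡ 3 + m
        ∣NC∣≡3+m = ∣NC∣≡ v eq (shift 3 0)

      defector-power : ∀ v b → block v ≡ b → F v ≡ D → power G w F v ≤ℚ ratio 1 (4 + m)
      defector-power v K eq Fv≡D = contradiction (trans (≡-sym Fv≡D) (plays v eq)) λ ()
      defector-power v X eq Fv≡D = ℚP.≤-trans
        (ℚP.≤-reflexive (C-wins⇒power≡0 G w F v Fv≡D (C-wins v (∣NC∣≡ v eq (shift 3 0)) w<k-1/k+1)))
        (ratio-nonneg 1 (4 + m))
      defector-power v Z eq Fv≡D = ℚP.≤-trans (D-power≤ v eq (shift 5 0) Fv≡D) 1/k+1≤1/k
      defector-power v Y eq Fv≡D = ℚP.≤-trans (D-power≤ v eq (shift 5 0) Fv≡D) 1/k+1≤1/k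
      defector-power v W eq Fv≡D = ℚP.≤-trans (D-power≤ v eq (shift 3 2) Fv≡D) 1/k+1≤1/k
      defector-power v V eq Fv≡D = ℚP.≤-trans (D-power≤ v eq (shift 3 2) Fv≡D) 1/k+1≤1/k

      C-dominates : ∀ u → F u ≡ C ⊎ power G w F u <ℚ ratio 1 (3 + m)
      C-dominates u =
        Sum.map₂ (λ Fu≡D → ℚP.≤-<-trans (defector-power u (block u) refl Fu≡D) 1/k<1/k-1) (C-or-D (F u))

      step-C-on-K : ∀ v b → block v ≡ b → step G w F v ≡ C-on-KX b
      step-C-on-K v K eq = step-adopts G w F v C _ v (v∈closedN G v)
        (ℚP.≤-reflexive (≡-sym (K-power v eq))) (λ u _ → C-dominates u)
      step-C-on-K v X eq = step-adopts G w F v C _ k₀ (joined⇒∈closedN k₀ v eq block-k₀ _)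
        (ℚP.≤-reflexive (≡-sym (K-power k₀ block-k₀))) (λ u _ → C-dominates u)
      step-C-on-K v Z eq = settled v eq λ { X _ → refl ; Y _ → refl ; K () ; Z () ; W () ; V () }
      step-C-on-K v Y eq = settled v eq λ { Z _ → refl ; W _ → refl ; K () ; X () ; Y () ; V () }
      step-C-on-K v W eq = settled v eq λ { Y _ → refl ; V _ → refl ; K () ; X () ; Z () ; W () }
      step-C-on-K v V eq = settled v eq λ { W _ → refl ; V _ → refl ; K () ; X () ; Z () ; Y () }

    module _ {F : Configuration G} (agree : Agrees F C-on-KX) where

      open AgreesWith C-on-KX agree

      Z-power : ∀ v → block v ≡ Z → power G w F v ≡ ratio 1 (3 + m)
      Z-power v eq =
        trans (D-wins⇒power≡1/∣ND∣ G w F v (plays v eq) D-wins) (cong (ratio 1) (∣ND∣≡ v eq (shift 3 0)))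
        where
        2/k+1≤w : ratio 2 (5 + m) ≤ℚ w
        2/k+1≤w = ℚP.≤-trans (ratio-≤ 2 (4 + m) 1 1 (s≤s (s≤s (s≤s (s≤s z≤n))))) ½≤w
        D-wins : ¬ CollaboratorsWin G w F v
        D-wins win = ℚP.<-irrefl refl
          (ℚP.<-≤-trans (subst₂ (λ a b → w <ℚ ratio a b) (∣NC∣≡ v eq refl) (∣closedN∣ v) win) 2/k+1≤w)

      collaborator-power : ∀ v b → block v ≡ b → F v ≡ C → power G w F v ≤ℚ ratio 1 (4 + m)
      collaborator-power v K eq Fv≡C = ℚP.≤-trans (C-power≤ v eq (shift 3 2) Fv≡C) 1/k+1≤1/k
      collaborator-power v X eq Fv≡C = C-power≤ v eq (shift 4 0) Fv≡C
      collaborator-power v Z eq Fv≡C = contradiction (trans (≡-sym Fv≡C) (plays v eq)) λ ()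
      collaborator-power v Y eq Fv≡C = contradiction (trans (≡-sym Fv≡C) (plays v eq)) λ ()
      collaborator-power v W eq Fv≡C = contradiction (trans (≡-sym Fv≡C) (plays v eq)) λ ()
      collaborator-power v V eq Fv≡C = contradiction (trans (≡-sym Fv≡C) (plays v eq)) λ ()

      D-dominates : ∀ u → F u ≡ D ⊎ power G w F u <ℚ ratio 1 (3 + m)
      D-dominates u =
        [ (λ Fu≡C → inj₂ (ℚP.≤-<-trans (collaborator-power u (block u) refl Fu≡C) 1/k<1/k-1)) , inj₁ ]′
        (C-or-D (F u))

      step-C-on-KX : ∀ v b → block v ≡ b → step G w F v ≡ C-on-K b
      step-C-on-KX v K eq = settled v eq λ { K _ → refl ; X _ → refl ; Z () ; Y () ; W () ; V () }
      step-C-on-KX v X eq = step-adopts G w F v D _ z₀ (joined⇒∈closedN z₀ v eq block-z₀ _)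
        (ℚP.≤-reflexive (≡-sym (Z-power z₀ block-z₀))) (λ u _ → D-dominates u)
      step-C-on-KX v Z eq = step-adopts G w F v D _ v (v∈closedN G v)
        (ℚP.≤-reflexive (≡-sym (Z-power v eq))) (λ u _ → D-dominates u)
      step-C-on-KX v Y eq = settled v eq λ { Z _ → refl ; W _ → refl ; K () ; X () ; Y () ; V () }
      step-C-on-KX v W eq = settled v eq λ { Y _ → refl ; V _ → refl ; K () ; X () ; Z () ; W () }
      step-C-on-KX v V eq = settled v eq λ { W _ → refl ; V _ → refl ; K () ; X () ; Z () ; Y () }

    step-phase : ∀ t {F} → Agrees F (phase t) → Agrees (step G w F) (phase (suc t))
    step-phase zero          agree v = step-C-on-K agree v (block v) refl
    step-phase (suc zero)    agree v = step-C-on-KX agree v (block v) refl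
    step-phase (suc (suc t)) agree   = step-phase t agree

    process-phase : ∀ t → Agrees (process G w (C-on-K ∘ block) t) (phase t)
    process-phase zero    v = refl
    process-phase (suc t)   = step-phase t (process-phase t)

    periodic : PeriodicWithPeriod G w (C-on-K ∘ block) 2
    periodic = period-two G w (C-on-K ∘ block) (process-phase 2) moves
      where
      moves : ∀ t → ∃ λ v → process G w (C-on-K ∘ block) t v ≢
                            process G w (C-on-K ∘ block) (suc t) v
      moves t = x₀ , λ same → phase-moves-X t (subst (λ b → phase t b ≡ phase (suc t) b) block-x₀
        (trans (≡-sym (process-phase t x₀)) (trans same (process-phase (suc t) x₀))))

mainTheorem8 : (k : ℕ) → 3 < k → (w : ℚ) → ½ ≤ℚ w → w <ℚ 1ℚ → ¬ InLastTwoParts k w →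
    Σ Graph λ G → Regular k G × Σ (Configuration G) λ C0 → ∃ λ ℓ → PeriodicWithPeriod G w C0 ℓ
mainTheorem8 _ (s≤s (s≤s (s≤s (s≤s {n = m} _)))) w ½≤w w<1 not-last =
  G , regular , C-on-K ∘ block , 2 , periodic
  where
  open Gadget m
  open Dynamics w ½≤w (ℚP.≰⇒> (λ k-1/k+1≤w → not-last (k-1/k+1≤w , w<1)))
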